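{- Let $(v_n)_{n\ge0}$ be the regular paperfolding sequence over $\mathbb{F}_2$: $v_0\in\mathbb{F}_2$ is arbitrary, and for $n\ge1$ written as $n=m\cdot 2^k$ with $m$ odd, $v_n=1$ if $m\equiv1\pmod 4$ and $v_n=0$ if $m\equiv 3\pmod 4$. Then for every $N\ge1$, $$\frac{N-3}{2}\le L(v_n,N)\le\frac{N}{2}+2.$$
   Context: The $N$th linear complexity $L(u_n,N)$ of a sequence $(u_n)$ over $\mathbb{F}_2$ is the least $L\ge 0$ such that there exist $c_0,\dots,c_{L-1}\in\mathbb{F}_2$ with $u_{n+L}=c_{L-1}u_{n+L-1}+\dots+c_0u_n$ for all $0\le n\le N-L-1$; by convention $L(u_n,N)=0$ if $u_0=\dots=u_{N-1}=0$, and $L(u_n,N)=N$ if $u_0=\dots=u_{N-2}=0\ne u_{N-1}$. -}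

module Defs where

open import Data.Bool using (Bool; true; false; _∧_; _xor_)
open import Data.Nat using (ℕ; zero; suc; _+_; _<_)
open import Data.Fin using (Fin)
import Data.Fin as Fin
open import Data.Product using (Σ; _×_)
open import Relation.Binary.PropositionalEquality using (_≡_)
open import Relation.Nullary using (¬_)

-- Sequences over F₂ are functions ℕ → Bool (xor = addition, ∧ = multiplication).

linSum : (L : ℕ) → (Fin L → Bool) → (ℕ → Bool) → ℕ → Bool
linSum zero    c u n = false
linSum (suc L) c u n = (c Fin.zero ∧ u n) xor linSum L (λ i → c (Fin.suc i)) u (suc n)

HasRecurrence : (ℕ → Bool) → ℕ → ℕ → Set
HasRecurrence u N L =
  Σ (Fin L → Bool) (λ c → ∀ n → n + L < N → u (n + L) ≡ linSum L c u n)

-- L is the N-th linear complexity L(u,N): the least L ≥ 0 admitting such a recurrence.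
-- (The conventions L = 0 for an all-zero prefix and L = N for 0…01 agree with this.)
IsLinearComplexity : (ℕ → Bool) → ℕ → ℕ → Set
IsLinearComplexity u N L = HasRecurrence u N L × (∀ L′ → L′ < L → ¬ HasRecurrence u N L′)

module Submission where

-- The generating polynomial G of v(0), …, v(N-1) satisfies
-- (1 + x⁴)(G² + G) ≡ x (mod x^N), since v(2k) = v(k) and v(2k+1) = 1 exactly
-- when 2k+1 ≡ 1 (mod 4).  A recurrence of length ℓ gives its reciprocal
-- connection polynomial D, with D(0) = 1 and deg D ≤ ℓ, and a polynomial P of
-- degree < ℓ with D·G ≡ P; hence (1 + x⁴)·P·(P + D) ≡ x·D² (mod x^N).  When
-- 2ℓ + 4 ≤ N both sides have degree < N and are equal.  Substituting x ↦ 1 + x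
-- and an infinite descent on the powers of x then force D(0) = 0.
--
-- The Berlekamp–Massey construction only lengthens its current
-- recurrence, of length ℓ, after a failure at position N, and then to length
-- N + 1 - ℓ; the lower bound for the old recurrence keeps 2ℓ ≤ N + 4.

open import Defs
open import Level using (0ℓ)
open import Data.Bool using (Bool; true; false; _∧_; _xor_)
open import Data.Bool.Properties
  using (xor-assoc; xor-comm; xor-same; xor-identityʳ; ∧-zeroʳ; ∧-assoc; ∧-comm; ∧-idem;
         ∧-distribˡ-xor; ∧-distribʳ-xor; xor-∧-commutativeRing)
open import Data.Nat using (ℕ; zero; suc; _+_; _*_; _^_; _%_; _≡ᵇ_; _∸_; _≤_; _<_; z≤n; s≤s; _≤?_)
open import Data.Nat.Properties
  using (+-suc; +-identityʳ; +-comm; *-identityʳ; ≤-refl; ≤-trans; ≤-<-trans; ≤-pred; ≤-reflexive; ≰⇒>; <⇒≤;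
         <-irrefl; m≤m+n; m≤n+m; n≤1+n; m≤n⇒m≤1+n; m≤n⇒m<n∨m≡n; m∸n+n≡m; m+[n∸m]≡n;
         +-cancelʳ-≤; +-monoʳ-≤; +-monoˡ-<; *-monoʳ-≤)
open import Data.Nat.DivMod using ([m+n]%n≡m%n; [m+kn]%n≡m%n)
open import Data.Nat.Induction using (<-rec)
open import Data.Nat.Tactic.RingSolver using (solve-∀)
open import Data.Fin using (Fin; toℕ)
import Data.Fin as Fin
open import Data.List using (List; []; _∷_)
open import Data.Maybe using (Maybe; just; nothing)
open import Data.Product using (Σ; _×_; _,_; proj₁; proj₂)
open import Data.Sum using (inj₁; inj₂)
open import Data.Empty using (⊥; ⊥-elim)
open import Relation.Nullary using (Dec; yes; no)
open import Relation.Binary.PropositionalEquality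
  using (_≡_; refl; sym; trans; cong; cong₂; subst; subst₂; module ≡-Reasoning)
open import Relation.Binary.Structures using (IsEquivalence)
open import Relation.Binary.Bundles using (Setoid)
open import Algebra.Bundles using (CommutativeSemigroup; CommutativeRing)
open import Algebra.Bundles.Raw using (RawRing)
import Algebra.Properties.CommutativeSemigroup as CommSemigroupProperties
import Algebra.Solver.Ring.AlmostCommutativeRing as ACR
import Algebra.Solver.Ring as RingSolver
import Relation.Binary.Reasoning.Setoid as SetoidReasoning

open CommSemigroupProperties (CommutativeRing.+-commutativeSemigroup xor-∧-commutativeRing)
  using () renaming (interchange to xor-interchange)

-- Polynomials over F₂ are coefficient lists, constant term first.  Lists that
-- differ by trailing zeros denote the same polynomial, so equality of
-- polynomials is equality of all coefficients.
Poly : Set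
Poly = List Bool

coef : Poly → ℕ → Bool
coef []      n       = false
coef (a ∷ p) zero    = a
coef (a ∷ p) (suc n) = coef p n

infix 4 _≈_
record _≈_ (p q : Poly) : Set where
  constructor mk≈
  field at : ∀ n → coef p n ≡ coef q n
open _≈_ public

≈-isEquivalence : IsEquivalence _≈_
≈-isEquivalence = record
  { refl  = mk≈ λ _ → refl
  ; sym   = λ e → mk≈ λ n → sym (at e n)
  ; trans = λ e f → mk≈ λ n → trans (at e n) (at f n)
  }

open IsEquivalence ≈-isEquivalence public
  using () renaming (refl to ≈-refl; sym to ≈-sym; trans to ≈-trans)

≈-setoid : Setoid 0ℓ 0ℓ
≈-setoid = record { isEquivalence = ≈-isEquivalence }

module ≈-Reasoning = SetoidReasoning ≈-setoid

∷-cong : ∀ {a b p q} → a ≡ b → p ≈ q → a ∷ p ≈ b ∷ q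
∷-cong a≡b p≈q = mk≈ λ { zero → a≡b ; (suc n) → at p≈q n }

infixl 6 _⊕_
infixl 7 _⊗_
infixr 8 x*_

_⊕_ : Poly → Poly → Poly
[]      ⊕ q       = q
(a ∷ p) ⊕ []      = a ∷ p
(a ∷ p) ⊕ (b ∷ q) = (a xor b) ∷ (p ⊕ q)

scale : Bool → Poly → Poly
scale a []      = []
scale a (b ∷ p) = (a ∧ b) ∷ scale a p

x*_ : Poly → Poly
x* p = false ∷ p

_⊗_ : Poly → Poly → Poly
[]      ⊗ q = []
(a ∷ p) ⊗ q = scale a q ⊕ x* (p ⊗ q)

cst : Bool → Poly
cst a = a ∷ []

one : Poly
one = cst true

coef-⊕ : ∀ p q n → coef (p ⊕ q) n ≡ coef p n xor coef q n
coef-⊕ []      q       n       = refl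
coef-⊕ (a ∷ p) []      n       = sym (xor-identityʳ _)
coef-⊕ (a ∷ p) (b ∷ q) zero    = refl
coef-⊕ (a ∷ p) (b ∷ q) (suc n) = coef-⊕ p q n

coef-scale : ∀ a p n → coef (scale a p) n ≡ a ∧ coef p n
coef-scale a []      n       = sym (∧-zeroʳ a)
coef-scale a (b ∷ p) zero    = refl
coef-scale a (b ∷ p) (suc n) = coef-scale a p n

⊕-cong : ∀ {p p′ q q′} → p ≈ p′ → q ≈ q′ → p ⊕ q ≈ p′ ⊕ q′
⊕-cong {p} {p′} {q} {q′} e f = mk≈ go
  where
  go : ∀ n → coef (p ⊕ q) n ≡ coef (p′ ⊕ q′) n
  go n rewrite coef-⊕ p q n | coef-⊕ p′ q′ n = cong₂ _xor_ (at e n) (at f n)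

⊕-assoc : ∀ p q r → (p ⊕ q) ⊕ r ≈ p ⊕ (q ⊕ r)
⊕-assoc p q r = mk≈ go
  where
  go : ∀ n → coef ((p ⊕ q) ⊕ r) n ≡ coef (p ⊕ (q ⊕ r)) n
  go n rewrite coef-⊕ (p ⊕ q) r n | coef-⊕ p q n | coef-⊕ p (q ⊕ r) n | coef-⊕ q r n =
    xor-assoc (coef p n) (coef q n) (coef r n)

⊕-comm : ∀ p q → p ⊕ q ≈ q ⊕ p
⊕-comm p q = mk≈ go
  where
  go : ∀ n → coef (p ⊕ q) n ≡ coef (q ⊕ p) n
  go n rewrite coef-⊕ p q n | coef-⊕ q p n = xor-comm (coef p n) (coef q n)

⊕-identityʳ : ∀ p → p ⊕ [] ≈ p
⊕-identityʳ p = mk≈ λ n → trans (coef-⊕ p [] n) (xor-identityʳ (coef p n))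

⊕-self : ∀ p → p ⊕ p ≈ []
⊕-self p = mk≈ λ n → trans (coef-⊕ p p n) (xor-same (coef p n))

⊕-commutativeSemigroup : CommutativeSemigroup 0ℓ 0ℓ
⊕-commutativeSemigroup = record
  { Carrier = Poly ; _≈_ = _≈_ ; _∙_ = _⊕_
  ; isCommutativeSemigroup = record
    { isSemigroup = record
      { isMagma = record { isEquivalence = ≈-isEquivalence ; ∙-cong = ⊕-cong }
      ; assoc = ⊕-assoc }
    ; comm = ⊕-comm }
  }

open CommSemigroupProperties ⊕-commutativeSemigroup
  using () renaming (interchange to ⊕-interchange; x∙yz≈y∙xz to ⊕-leftComm)

scale-cong : ∀ a {p q} → p ≈ q → scale a p ≈ scale a q
scale-cong a {p} {q} e = mk≈ go
  where
  go : ∀ n → coef (scale a p) n ≡ coef (scale a q) n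
  go n rewrite coef-scale a p n | coef-scale a q n = cong (a ∧_) (at e n)

scale-false : ∀ p → scale false p ≈ []
scale-false p = mk≈ (coef-scale false p)

scale-true : ∀ p → scale true p ≈ p
scale-true p = mk≈ (coef-scale true p)

scale-⊕ : ∀ a p q → scale a (p ⊕ q) ≈ scale a p ⊕ scale a q
scale-⊕ a p q = mk≈ go
  where
  go : ∀ n → coef (scale a (p ⊕ q)) n ≡ coef (scale a p ⊕ scale a q) n
  go n rewrite coef-scale a (p ⊕ q) n | coef-⊕ p q n | coef-⊕ (scale a p) (scale a q) n
             | coef-scale a p n | coef-scale a q n = ∧-distribˡ-xor a (coef p n) (coef q n)

scale-xor : ∀ a b p → scale (a xor b) p ≈ scale a p ⊕ scale b p
scale-xor a b p = mk≈ go
  where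
  go : ∀ n → coef (scale (a xor b) p) n ≡ coef (scale a p ⊕ scale b p) n
  go n rewrite coef-scale (a xor b) p n | coef-⊕ (scale a p) (scale b p) n
             | coef-scale a p n | coef-scale b p n = ∧-distribʳ-xor (coef p n) a b

scale-scale : ∀ a b p → scale a (scale b p) ≈ scale (a ∧ b) p
scale-scale a b p = mk≈ go
  where
  go : ∀ n → coef (scale a (scale b p)) n ≡ coef (scale (a ∧ b) p) n
  go n rewrite coef-scale a (scale b p) n | coef-scale b p n | coef-scale (a ∧ b) p n =
    sym (∧-assoc a b (coef p n))

x*-zero : x* [] ≈ []
x*-zero = mk≈ λ { zero → refl ; (suc n) → refl }

scale-x* : ∀ a p → scale a (x* p) ≈ x* scale a p
scale-x* a p = ∷-cong (∧-zeroʳ a) ≈-refl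

-- Multiplication.  The recursion is on the left factor; the mirrored
-- recursion ⊗-∷ʳ on the right factor yields commutativity.
⊗-congʳ : ∀ p {q q′} → q ≈ q′ → p ⊗ q ≈ p ⊗ q′
⊗-congʳ []      e = ≈-refl
⊗-congʳ (a ∷ p) e = ⊕-cong (scale-cong a e) (∷-cong refl (⊗-congʳ p e))

⊗-zeroʳ : ∀ p → p ⊗ [] ≈ []
⊗-zeroʳ []      = ≈-refl
⊗-zeroʳ (a ∷ p) = mk≈ λ { zero → refl ; (suc n) → at (⊗-zeroʳ p) n }

x*-⊗ : ∀ p q → x* p ⊗ q ≈ x* (p ⊗ q)
x*-⊗ p q = ⊕-cong (scale-false q) ≈-refl

⊗-∷ʳ : ∀ p b q → p ⊗ (b ∷ q) ≈ scale b p ⊕ x* (p ⊗ q)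
⊗-∷ʳ []      b q = ≈-sym x*-zero
⊗-∷ʳ (a ∷ p) b q = ∷-cong (cong (_xor false) (∧-comm a b)) (≈-trans
  (⊕-cong (≈-refl {scale a q}) (⊗-∷ʳ p b q))
  (⊕-leftComm (scale a q) (scale b p) (x* (p ⊗ q))))

⊗-comm : ∀ p q → p ⊗ q ≈ q ⊗ p
⊗-comm []      q = ≈-sym (⊗-zeroʳ q)
⊗-comm (a ∷ p) q = ≈-trans (⊕-cong ≈-refl (∷-cong refl (⊗-comm p q))) (≈-sym (⊗-∷ʳ q a p))

⊗-congˡ : ∀ {p p′} q → p ≈ p′ → p ⊗ q ≈ p′ ⊗ q
⊗-congˡ {p} {p′} q e = ≈-trans (⊗-comm p q) (≈-trans (⊗-congʳ q e) (⊗-comm q p′))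

⊗-cong : ∀ {p p′ q q′} → p ≈ p′ → q ≈ q′ → p ⊗ q ≈ p′ ⊗ q′
⊗-cong {p′ = p′} {q = q} e f = ≈-trans (⊗-congˡ q e) (⊗-congʳ p′ f)

⊗-distribʳ : ∀ r p q → (p ⊕ q) ⊗ r ≈ p ⊗ r ⊕ q ⊗ r
⊗-distribʳ r []      q       = ≈-refl
⊗-distribʳ r (a ∷ p) []      = ≈-sym (⊕-identityʳ _)
⊗-distribʳ r (a ∷ p) (b ∷ q) = ≈-trans
  (⊕-cong (scale-xor a b r) (∷-cong refl (⊗-distribʳ r p q)))
  (⊕-interchange (scale a r) (scale b r) (x* (p ⊗ r)) (x* (q ⊗ r)))

⊗-distribˡ : ∀ p q r → p ⊗ (q ⊕ r) ≈ p ⊗ q ⊕ p ⊗ r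
⊗-distribˡ p q r = ≈-trans (⊗-comm p (q ⊕ r))
  (≈-trans (⊗-distribʳ p q r) (⊕-cong (⊗-comm q p) (⊗-comm r p)))

scale-⊗ : ∀ a p q → scale a p ⊗ q ≈ scale a (p ⊗ q)
scale-⊗ a []      q = ≈-refl
scale-⊗ a (b ∷ p) q = ≈-sym (begin
  scale a (scale b q ⊕ x* (p ⊗ q))         ≈⟨ scale-⊕ a (scale b q) (x* (p ⊗ q)) ⟩
  scale a (scale b q) ⊕ scale a (x* (p ⊗ q)) ≈⟨ ⊕-cong (scale-scale a b q) (scale-x* a (p ⊗ q)) ⟩
  scale (a ∧ b) q ⊕ x* scale a (p ⊗ q)     ≈⟨ ⊕-cong ≈-refl (∷-cong refl (≈-sym (scale-⊗ a p q))) ⟩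
  scale (a ∧ b) q ⊕ x* (scale a p ⊗ q)     ∎)
  where open ≈-Reasoning

⊗-assoc : ∀ p q r → (p ⊗ q) ⊗ r ≈ p ⊗ (q ⊗ r)
⊗-assoc []      q r = ≈-refl
⊗-assoc (a ∷ p) q r = begin
  (scale a q ⊕ x* (p ⊗ q)) ⊗ r       ≈⟨ ⊗-distribʳ r (scale a q) (x* (p ⊗ q)) ⟩
  scale a q ⊗ r ⊕ x* (p ⊗ q) ⊗ r     ≈⟨ ⊕-cong (scale-⊗ a q r) (x*-⊗ (p ⊗ q) r) ⟩
  scale a (q ⊗ r) ⊕ x* ((p ⊗ q) ⊗ r) ≈⟨ ⊕-cong ≈-refl (∷-cong refl (⊗-assoc p q r)) ⟩
  scale a (q ⊗ r) ⊕ x* (p ⊗ (q ⊗ r)) ∎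
  where open ≈-Reasoning

⊗-identityˡ : ∀ p → one ⊗ p ≈ p
⊗-identityˡ p = ≈-trans (⊕-cong (scale-true p) x*-zero) (⊕-identityʳ p)

⊗-identityʳ : ∀ p → p ⊗ one ≈ p
⊗-identityʳ p = ≈-trans (⊗-comm p one) (⊗-identityˡ p)

F₂[x] : CommutativeRing 0ℓ 0ℓ
F₂[x] = record
  { Carrier = Poly ; _≈_ = _≈_ ; _+_ = _⊕_ ; _*_ = _⊗_ ; -_ = λ p → p ; 0# = [] ; 1# = one
  ; isCommutativeRing = record
    { isRing = record
      { +-isAbelianGroup = record
        { isGroup = record
          { isMonoid = record
            { isSemigroup = CommutativeSemigroup.isSemigroup ⊕-commutativeSemigroup
            ; identity = (λ p → ≈-refl) , ⊕-identityʳ }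
          ; inverse = ⊕-self , ⊕-self
          ; ⁻¹-cong = λ e → e }
        ; comm = ⊕-comm }
      ; *-cong = ⊗-cong
      ; *-assoc = ⊗-assoc
      ; *-identity = ⊗-identityˡ , ⊗-identityʳ
      ; distrib = ⊗-distribˡ , ⊗-distribʳ }
    ; *-comm = ⊗-comm }
  }

cst-⊕ : ∀ a b → cst (a xor b) ≈ cst a ⊕ cst b
cst-⊕ a b = ≈-refl

cst-⊗ : ∀ a b → cst (a ∧ b) ≈ cst a ⊗ cst b
cst-⊗ a b = ∷-cong (sym (xor-identityʳ (a ∧ b))) ≈-refl

-- A ring solver for F₂[x] with constant coefficients in F₂; since coefficients
-- are added in F₂ it also proves characteristic-2 identities such as
-- (p + q)² = p² + q².
private
  F₂ : RawRing 0ℓ 0ℓ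
  F₂ = CommutativeRing.rawRing xor-∧-commutativeRing

  cst-homomorphism : F₂ ACR.-Raw-AlmostCommutative⟶ ACR.fromCommutativeRing F₂[x]
  cst-homomorphism = record
    { ⟦_⟧    = cst
    ; +-homo = cst-⊕
    ; *-homo = cst-⊗
    ; -‿homo = λ a → ≈-refl
    ; 0-homo = x*-zero
    ; 1-homo = ≈-refl
    }

  cst-equal? : ∀ a b → Maybe (cst a ≈ cst b)
  cst-equal? false false = just ≈-refl
  cst-equal? true  true  = just ≈-refl
  cst-equal? _     _     = nothing

module PolySolver = RingSolver F₂ (ACR.fromCommutativeRing F₂[x]) cst-homomorphism cst-equal?
open PolySolver using (solve; con; _:+_; _:*_; _:=_)

spread : Poly → Poly
spread []      = []
spread (a ∷ p) = a ∷ false ∷ spread p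

coef-spread-even : ∀ p k → coef (spread p) (k + k) ≡ coef p k
coef-spread-even []      k       = refl
coef-spread-even (a ∷ p) zero    = refl
coef-spread-even (a ∷ p) (suc k) rewrite +-suc k k = coef-spread-even p k

coef-spread-odd : ∀ p k → coef (spread p) (suc (k + k)) ≡ false
coef-spread-odd []      k       = refl
coef-spread-odd (a ∷ p) zero    = refl
coef-spread-odd (a ∷ p) (suc k) rewrite +-suc k k = coef-spread-odd p k

-- Frobenius: p² = p(x²); the cross terms a·p + p·a cancel.
square≈spread : ∀ p → p ⊗ p ≈ spread p
square≈spread []      = ≈-refl
square≈spread (a ∷ p) = ∷-cong (trans (xor-identityʳ (a ∧ a)) (∧-idem a)) (begin
  scale a p ⊕ p ⊗ (a ∷ p)                 ≈⟨ ⊕-cong (≈-refl {scale a p}) (⊗-∷ʳ p a p) ⟩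
  scale a p ⊕ (scale a p ⊕ x* (p ⊗ p))    ≈⟨ ≈-sym (⊕-assoc (scale a p) (scale a p) (x* (p ⊗ p))) ⟩
  (scale a p ⊕ scale a p) ⊕ x* (p ⊗ p)    ≈⟨ ⊕-cong (⊕-self (scale a p)) (∷-cong refl (square≈spread p)) ⟩
  x* spread p                             ∎)
  where open ≈-Reasoning

-- Multiplication by x: x* prepends a zero coefficient, which makes coefficients
-- easy to read off, while X ⊗ _ is the form the ring solver works with.
X : Poly
X = x* one

x*≈X⊗ : ∀ p → x* p ≈ X ⊗ p
x*≈X⊗ p = ≈-sym (≈-trans (x*-⊗ one p) (∷-cong refl (⊗-identityˡ p)))

x*-injective : ∀ {p q} → x* p ≈ x* q → p ≈ q
x*-injective e = mk≈ λ n → at e (suc n)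

X⊗-injective : ∀ {p q} → X ⊗ p ≈ X ⊗ q → p ≈ q
X⊗-injective {p} {q} e = x*-injective (≈-trans (x*≈X⊗ p) (≈-trans e (≈-sym (x*≈X⊗ q))))

coef-X⊗-zero : ∀ p → coef (X ⊗ p) 0 ≡ false
coef-X⊗-zero p = sym (at (x*≈X⊗ p) 0)

coef-X⊗-suc : ∀ p n → coef (X ⊗ p) (suc n) ≡ coef p n
coef-X⊗-suc p n = sym (at (x*≈X⊗ p) (suc n))

tail : Poly → Poly
tail []      = []
tail (a ∷ p) = p

divide-by-X : ∀ p → coef p 0 ≡ false → p ≈ X ⊗ tail p
divide-by-X p p₀≡0 = ≈-trans (split p p₀≡0) (x*≈X⊗ (tail p))
  where
  split : ∀ p → coef p 0 ≡ false → p ≈ x* tail p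
  split []      _  = ≈-sym x*-zero
  split (a ∷ p) eq = ∷-cong eq ≈-refl

coef-tail : ∀ p n → coef (tail p) n ≡ coef p (suc n)
coef-tail []      n = refl
coef-tail (a ∷ p) n = refl

⊕≈[]⇒≈ : ∀ {p q} → p ⊕ q ≈ [] → p ≈ q
⊕≈[]⇒≈ {p} {q} e = ≈-trans (solve 2 (λ p q → p := (p :+ q) :+ q) ≈-refl p q) (⊕-cong e (≈-refl {q}))

≈⇒⊕≈[] : ∀ {p q} → p ≈ q → p ⊕ q ≈ []
≈⇒⊕≈[] {p} {q} e = ≈-trans (⊕-cong e (≈-refl {q})) (⊕-self q)

infix 4 _deg<_
record _deg<_ (p : Poly) (n : ℕ) : Set where
  constructor mk-deg<
  field vanishes : ∀ m → n ≤ m → coef p m ≡ false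
open _deg<_ public

deg<-mono : ∀ {p m n} → m ≤ n → p deg< m → p deg< n
deg<-mono m≤n d = mk-deg< λ k n≤k → vanishes d k (≤-trans m≤n n≤k)

deg<-≈ : ∀ {p q n} → p ≈ q → p deg< n → q deg< n
deg<-≈ e d = mk-deg< λ m n≤m → trans (sym (at e m)) (vanishes d m n≤m)

deg<-⊕ : ∀ {p q n} → p deg< n → q deg< n → (p ⊕ q) deg< n
deg<-⊕ {p} {q} dp dq = mk-deg< λ m n≤m → trans (coef-⊕ p q m) (cong₂ _xor_ (vanishes dp m n≤m) (vanishes dq m n≤m))

deg<-zero : ∀ {p} → p deg< 0 → p ≈ []
deg<-zero d = mk≈ λ n → vanishes d n z≤n

deg<-tail : ∀ {c p n} → (c ∷ p) deg< suc n → p deg< n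
deg<-tail d = mk-deg< λ m n≤m → vanishes d (suc m) (s≤s n≤m)

deg<-scale : ∀ c {q n} → q deg< n → scale c q deg< n
deg<-scale c {q} d = mk-deg< λ m n≤m → trans (coef-scale c q m) (trans (cong (c ∧_) (vanishes d m n≤m)) (∧-zeroʳ c))

deg<-x* : ∀ {p n} → p deg< n → x* p deg< suc n
deg<-x* d = mk-deg< λ { zero () ; (suc m) (s≤s n≤m) → vanishes d m n≤m }

deg<-⊗ : ∀ {a b p q} → p deg< suc a → q deg< b → (p ⊗ q) deg< (a + b)
deg<-⊗ {p = []}                   dp dq = mk-deg< λ _ _ → refl
deg<-⊗ {zero}  {b} {c ∷ p} {q} dp dq = deg<-⊕ (deg<-scale c dq) (deg<-≈ (≈-sym pq≈[]) (mk-deg< λ _ _ → refl))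
  where
  pq≈[] : x* (p ⊗ q) ≈ []
  pq≈[] = ≈-trans (∷-cong refl (⊗-congˡ q (deg<-zero (deg<-tail dp)))) x*-zero
deg<-⊗ {suc a} {b} {c ∷ p} {q} dp dq =
  deg<-⊕ (deg<-mono (m≤n+m b (suc a)) (deg<-scale c dq)) (deg<-x* (deg<-⊗ (deg<-tail dp) dq))

-- p ≈ q mod N: p and q agree below degree N, i.e. p ≡ q (mod x^N).
infix 4 _≈_mod_
record _≈_mod_ (p q : Poly) (N : ℕ) : Set where
  constructor mk≈mod
  field atBelow : ∀ n → n < N → coef p n ≡ coef q n
open _≈_mod_ public

≈⇒≈mod : ∀ {N p q} → p ≈ q → p ≈ q mod N
≈⇒≈mod e = mk≈mod λ n _ → at e n

≈mod-sym : ∀ {N p q} → p ≈ q mod N → q ≈ p mod N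
≈mod-sym e = mk≈mod λ n n<N → sym (atBelow e n n<N)

≈mod-trans : ∀ {N p q r} → p ≈ q mod N → q ≈ r mod N → p ≈ r mod N
≈mod-trans e f = mk≈mod λ n n<N → trans (atBelow e n n<N) (atBelow f n n<N)

≈mod-setoid : ℕ → Setoid 0ℓ 0ℓ
≈mod-setoid N = record
  { Carrier = Poly ; _≈_ = λ p q → p ≈ q mod N
  ; isEquivalence = record { refl = ≈⇒≈mod ≈-refl ; sym = ≈mod-sym ; trans = ≈mod-trans } }

module ≈mod-Reasoning (N : ℕ) = SetoidReasoning (≈mod-setoid N)

⊕-cong-mod : ∀ {N p p′ q q′} → p ≈ p′ mod N → q ≈ q′ mod N → p ⊕ q ≈ p′ ⊕ q′ mod N
⊕-cong-mod {N} {p} {p′} {q} {q′} e f = mk≈mod go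
  where
  go : ∀ n → n < N → coef (p ⊕ q) n ≡ coef (p′ ⊕ q′) n
  go n n<N rewrite coef-⊕ p q n | coef-⊕ p′ q′ n = cong₂ _xor_ (atBelow e n n<N) (atBelow f n n<N)

x*-cong-mod : ∀ {N p q} → p ≈ q mod N → x* p ≈ x* q mod suc N
x*-cong-mod e = mk≈mod λ { zero _ → refl ; (suc n) (s≤s n<N) → atBelow e n n<N }

≈mod-weaken : ∀ {N p q} → p ≈ q mod suc N → p ≈ q mod N
≈mod-weaken e = mk≈mod λ n n<N → atBelow e n (m≤n⇒m≤1+n n<N)

⊗-congʳ-mod : ∀ {N} p {q q′} → q ≈ q′ mod N → p ⊗ q ≈ p ⊗ q′ mod N
⊗-congʳ-mod []      e = mk≈mod λ _ _ → refl
⊗-congʳ-mod {zero}  (a ∷ p) e = mk≈mod λ _ ()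
⊗-congʳ-mod {suc N} (a ∷ p) {q} {q′} e = ⊕-cong-mod scaled (x*-cong-mod (⊗-congʳ-mod p (≈mod-weaken e)))
  where
  scaled : scale a q ≈ scale a q′ mod suc N
  scaled = mk≈mod λ n n<N → trans (coef-scale a q n) (trans (cong (a ∧_) (atBelow e n n<N)) (sym (coef-scale a q′ n)))

⊗-cong-mod : ∀ {N p p′ q q′} → p ≈ p′ mod N → q ≈ q′ mod N → p ⊗ q ≈ p′ ⊗ q′ mod N
⊗-cong-mod {N} {p} {p′} {q} {q′} e f =
  ≈mod-trans (⊗-congʳ-mod p f) (≈mod-trans (≈⇒≈mod (⊗-comm p q′))
  (≈mod-trans (⊗-congʳ-mod q′ e) (≈⇒≈mod (⊗-comm q′ p′))))

≈mod⇒≈ : ∀ {N p q} → p ≈ q mod N → p deg< N → q deg< N → p ≈ q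
≈mod⇒≈ {N} {p} {q} e dp dq = mk≈ λ n → go n (N ≤? n)
  where
  go : ∀ n → Dec (N ≤ n) → coef p n ≡ coef q n
  go n (yes N≤n) = trans (vanishes dp n N≤n) (sym (vanishes dq n N≤n))
  go n (no  N≰n) = atBelow e n (≰⇒> N≰n)

coef₀-⊗ : ∀ p q → coef (p ⊗ q) 0 ≡ coef p 0 ∧ coef q 0
coef₀-⊗ []      q = refl
coef₀-⊗ (a ∷ p) q = trans (coef-⊕ (scale a q) (x* (p ⊗ q)) 0) (trans (xor-identityʳ _) (coef-scale a q 0))

coef₀-square : ∀ p → coef (p ⊗ p) 0 ≡ coef p 0
coef₀-square p = trans (coef₀-⊗ p p) (∧-idem (coef p 0))

eval₁ : Poly → Bool
eval₁ []      = false
eval₁ (a ∷ p) = a xor eval₁ p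

eval₁-⊕ : ∀ p q → eval₁ (p ⊕ q) ≡ eval₁ p xor eval₁ q
eval₁-⊕ []      q       = refl
eval₁-⊕ (a ∷ p) []      = sym (xor-identityʳ _)
eval₁-⊕ (a ∷ p) (b ∷ q) = trans (cong ((a xor b) xor_) (eval₁-⊕ p q)) (xor-interchange a b (eval₁ p) (eval₁ q))

eval₁-scale : ∀ a p → eval₁ (scale a p) ≡ a ∧ eval₁ p
eval₁-scale a []      = sym (∧-zeroʳ a)
eval₁-scale a (b ∷ p) = trans (cong ((a ∧ b) xor_) (eval₁-scale a p)) (sym (∧-distribˡ-xor a b (eval₁ p)))

eval₁-⊗ : ∀ p q → eval₁ (p ⊗ q) ≡ eval₁ p ∧ eval₁ q
eval₁-⊗ []      q = refl
eval₁-⊗ (a ∷ p) q = trans (eval₁-⊕ (scale a q) (x* (p ⊗ q)))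
  (trans (cong₂ _xor_ (eval₁-scale a q) (eval₁-⊗ p q)) (sym (∧-distribʳ-xor (eval₁ q) a (eval₁ p))))

eval₁-≈[] : ∀ {p} → p ≈ [] → eval₁ p ≡ false
eval₁-≈[] {[]}    e = refl
eval₁-≈[] {a ∷ p} e = cong₂ _xor_ (at e 0) (eval₁-≈[] {p} (mk≈ λ n → at e (suc n)))

-- The substitution x ↦ 1 + x, written σ, is a ring endomorphism of F₂[x];
-- it exchanges the points 0 and 1, and turns 1 + x⁴ = (1 + x)⁴ into x⁴.
T : Poly
T = one ⊕ X

σ : Poly → Poly
σ []      = []
σ (a ∷ p) = cst a ⊕ T ⊗ σ p

σ-⊕ : ∀ p q → σ (p ⊕ q) ≈ σ p ⊕ σ q
σ-⊕ []      q       = ≈-refl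
σ-⊕ (a ∷ p) []      = ≈-sym (⊕-identityʳ _)
σ-⊕ (a ∷ p) (b ∷ q) = begin
  cst (a xor b) ⊕ T ⊗ σ (p ⊕ q)       ≈⟨ ⊕-cong (cst-⊕ a b) (⊗-congʳ T (σ-⊕ p q)) ⟩
  (cst a ⊕ cst b) ⊕ T ⊗ (σ p ⊕ σ q)   ≈⟨ solve 5 (λ A B t x y → (A :+ B) :+ t :* (x :+ y) := (A :+ t :* x) :+ (B :+ t :* y))
                                                ≈-refl (cst a) (cst b) T (σ p) (σ q) ⟩
  (cst a ⊕ T ⊗ σ p) ⊕ (cst b ⊕ T ⊗ σ q) ∎
  where open ≈-Reasoning

σ-≈[] : ∀ {p} → p ≈ [] → σ p ≈ []
σ-≈[] {[]}    e = ≈-refl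
σ-≈[] {a ∷ p} e = begin
  cst a ⊕ T ⊗ σ p  ≈⟨ ⊕-cong (∷-cong (at e 0) ≈-refl) (⊗-congʳ T (σ-≈[] {p} (mk≈ λ n → at e (suc n)))) ⟩
  cst false ⊕ T ⊗ [] ≈⟨ ⊕-cong x*-zero (⊗-zeroʳ T) ⟩
  []               ∎
  where open ≈-Reasoning

σ-cong : ∀ {p q} → p ≈ q → σ p ≈ σ q
σ-cong {p} {q} e = ⊕≈[]⇒≈ (≈-trans (≈-sym (σ-⊕ p q)) (σ-≈[] (≈⇒⊕≈[] e)))

σ-scale : ∀ a q → σ (scale a q) ≈ cst a ⊗ σ q
σ-scale a []      = ≈-sym (⊗-zeroʳ (cst a))
σ-scale a (b ∷ q) = begin
  cst (a ∧ b) ⊕ T ⊗ σ (scale a q)     ≈⟨ ⊕-cong (cst-⊗ a b) (⊗-congʳ T (σ-scale a q)) ⟩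
  cst a ⊗ cst b ⊕ T ⊗ (cst a ⊗ σ q)   ≈⟨ solve 4 (λ A B t x → A :* B :+ t :* (A :* x) := A :* (B :+ t :* x))
                                               ≈-refl (cst a) (cst b) T (σ q) ⟩
  cst a ⊗ (cst b ⊕ T ⊗ σ q)           ∎
  where open ≈-Reasoning

σ-⊗ : ∀ p q → σ (p ⊗ q) ≈ σ p ⊗ σ q
σ-⊗ []      q = ≈-refl
σ-⊗ (a ∷ p) q = begin
  σ (scale a q ⊕ x* (p ⊗ q))                    ≈⟨ σ-⊕ (scale a q) (x* (p ⊗ q)) ⟩
  σ (scale a q) ⊕ (cst false ⊕ T ⊗ σ (p ⊗ q))   ≈⟨ ⊕-cong (σ-scale a q) (⊕-cong x*-zero (⊗-congʳ T (σ-⊗ p q))) ⟩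
  cst a ⊗ σ q ⊕ T ⊗ (σ p ⊗ σ q)                 ≈⟨ solve 4 (λ A t x y → A :* y :+ t :* (x :* y) := (A :+ t :* x) :* y)
                                                         ≈-refl (cst a) T (σ p) (σ q) ⟩
  (cst a ⊕ T ⊗ σ p) ⊗ σ q                       ∎
  where open ≈-Reasoning

eval₁-σ : ∀ p → eval₁ (σ p) ≡ coef p 0
eval₁-σ []      = refl
eval₁-σ (a ∷ p) = trans (eval₁-⊕ (cst a) (T ⊗ σ p))
  (trans (cong₂ _xor_ (xor-identityʳ a) (eval₁-⊗ T (σ p))) (xor-identityʳ a))

DescentEq : Poly → Poly → Set
DescentEq E R = E ⊗ E ≈ X ⊗ (R ⊗ R ⊕ E ⊗ E ⊕ X ⊗ (E ⊗ R))

descent-step : ∀ E R → DescentEq E R → (coef E 0 ≡ false) × DescentEq (tail E) (tail R)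
descent-step E R h = E₀≡0 , X⊗-injective (X⊗-injective reduced)
  where
  S : Poly
  S = R ⊗ R ⊕ E ⊗ E ⊕ X ⊗ (E ⊗ R)
  E₀≡0 : coef E 0 ≡ false
  E₀≡0 = trans (sym (coef₀-square E)) (trans (at h 0) (coef-X⊗-zero S))
  S₀≡R₀ : coef S 0 ≡ coef R 0
  S₀≡R₀ rewrite coef-⊕ (R ⊗ R ⊕ E ⊗ E) (X ⊗ (E ⊗ R)) 0 | coef-⊕ (R ⊗ R) (E ⊗ E) 0
              | coef₀-square R | coef₀-square E | E₀≡0 | coef-X⊗-zero (E ⊗ R) =
    trans (xor-identityʳ _) (xor-identityʳ _)
  -- The coefficient of x in E² = E(x²) vanishes; on the right it is S(0) = R(0).
  R₀≡0 : coef R 0 ≡ false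
  R₀≡0 = begin
    coef R 0           ≡⟨ sym S₀≡R₀ ⟩
    coef S 0           ≡⟨ sym (coef-X⊗-suc S 0) ⟩
    coef (X ⊗ S) 1     ≡⟨ sym (at h 1) ⟩
    coef (E ⊗ E) 1     ≡⟨ at (square≈spread E) 1 ⟩
    coef (spread E) 1  ≡⟨ coef-spread-odd E 0 ⟩
    false              ∎
    where open ≡-Reasoning
  E′ : Poly
  E′ = tail E
  R′ : Poly
  R′ = tail R
  E≈ : E ≈ X ⊗ E′
  E≈ = divide-by-X E E₀≡0
  R≈ : R ≈ X ⊗ R′
  R≈ = divide-by-X R R₀≡0
  -- Substituting E = x·E′ and R = x·R′ multiplies both sides by x².
  reduced : X ⊗ (X ⊗ (E′ ⊗ E′)) ≈ X ⊗ (X ⊗ (X ⊗ (R′ ⊗ R′ ⊕ E′ ⊗ E′ ⊕ X ⊗ (E′ ⊗ R′))))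
  reduced = begin
    X ⊗ (X ⊗ (E′ ⊗ E′))
      ≈⟨ solve 2 (λ x e → x :* (x :* (e :* e)) := (x :* e) :* (x :* e)) ≈-refl X E′ ⟩
    (X ⊗ E′) ⊗ (X ⊗ E′)
      ≈⟨ ⊗-cong (≈-sym E≈) (≈-sym E≈) ⟩
    E ⊗ E
      ≈⟨ h ⟩
    X ⊗ S
      ≈⟨ ⊗-congʳ X (⊕-cong (⊕-cong (⊗-cong R≈ R≈) (⊗-cong E≈ E≈)) (⊗-congʳ X (⊗-cong E≈ R≈))) ⟩
    X ⊗ ((X ⊗ R′) ⊗ (X ⊗ R′) ⊕ (X ⊗ E′) ⊗ (X ⊗ E′) ⊕ X ⊗ ((X ⊗ E′) ⊗ (X ⊗ R′)))
      ≈⟨ solve 3 (λ x e r → x :* ((x :* r) :* (x :* r) :+ (x :* e) :* (x :* e) :+ x :* ((x :* e) :* (x :* r)))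
                          := x :* (x :* (x :* (r :* r :+ e :* e :+ x :* (e :* r))))) ≈-refl X E′ R′ ⟩
    X ⊗ (X ⊗ (X ⊗ (R′ ⊗ R′ ⊕ E′ ⊗ E′ ⊕ X ⊗ (E′ ⊗ R′)))) ∎
    where open ≈-Reasoning

descent : ∀ E R → DescentEq E R → E ≈ []
descent E R h = mk≈ λ k → vanish k E R h
  where
  vanish : ∀ k E R → DescentEq E R → coef E k ≡ false
  vanish zero    E R h = proj₁ (descent-step E R h)
  vanish (suc k) E R h = trans (sym (coef-tail E k)) (vanish k (tail E) (tail R) (proj₂ (descent-step E R h)))

X⁴ : Poly
X⁴ = X ⊗ X ⊗ X ⊗ X

deg<-X : X deg< 2
deg<-X = mk-deg< λ { (suc (suc m)) _ → refl ; 0 () ; 1 (s≤s ()) }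

deg<-1+X⁴ : (one ⊕ X⁴) deg< 5
deg<-1+X⁴ = mk-deg< λ
  { (suc (suc (suc (suc (suc m))))) _ → refl
  ; 0 () ; 1 (s≤s ()) ; 2 (s≤s (s≤s ())) ; 3 (s≤s (s≤s (s≤s ()))) ; 4 (s≤s (s≤s (s≤s (s≤s ())))) }

X⁴⊗≈x*⁴ : ∀ r → X⁴ ⊗ r ≈ x* x* x* x* r
X⁴⊗≈x*⁴ r = begin
  X⁴ ⊗ r                   ≈⟨ solve 2 (λ x r → x :* x :* x :* x :* r := x :* (x :* (x :* (x :* r)))) ≈-refl X r ⟩
  X ⊗ (X ⊗ (X ⊗ (X ⊗ r)))  ≈⟨ ⊗-congʳ X (⊗-congʳ X (⊗-congʳ X (≈-sym (x*≈X⊗ r)))) ⟩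
  X ⊗ (X ⊗ (X ⊗ x* r))     ≈⟨ ⊗-congʳ X (⊗-congʳ X (≈-sym (x*≈X⊗ (x* r)))) ⟩
  X ⊗ (X ⊗ x* x* r)        ≈⟨ ⊗-congʳ X (≈-sym (x*≈X⊗ (x* x* r))) ⟩
  X ⊗ x* x* x* r           ≈⟨ ≈-sym (x*≈X⊗ (x* x* x* r)) ⟩
  x* x* x* x* r            ∎
  where open ≈-Reasoning

coef-X⁴⊗ : ∀ p n → n < 4 → coef (X⁴ ⊗ p) n ≡ false
coef-X⁴⊗ p n n<4 = trans (at (X⁴⊗≈x*⁴ p) n) (below n n<4)
  where
  below : ∀ n → n < 4 → coef (x* x* x* x* p) n ≡ false
  below 0 _ = refl
  below 1 _ = refl
  below 2 _ = refl
  below 3 _ = refl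
  below (suc (suc (suc (suc n)))) (s≤s (s≤s (s≤s (s≤s ()))))

coef-X⁴⊗-shift : ∀ p n → coef (X⁴ ⊗ p) (4 + n) ≡ coef p n
coef-X⁴⊗-shift p n = at (X⁴⊗≈x*⁴ p) (4 + n)

X⁴⊗-injective : ∀ {p q} → X⁴ ⊗ p ≈ X⁴ ⊗ q → p ≈ q
X⁴⊗-injective {p} {q} e =
  x*-injective (x*-injective (x*-injective (x*-injective (≈-trans (≈-sym (X⁴⊗≈x*⁴ p)) (≈-trans e (X⁴⊗≈x*⁴ q))))))

coef-T⊗square : ∀ D k → coef (T ⊗ (D ⊗ D)) (k + k) ≡ coef D k
coef-T⊗square D k = begin
  coef (T ⊗ (D ⊗ D)) (k + k)                         ≡⟨ at expand (k + k) ⟩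
  coef (D ⊗ D ⊕ X ⊗ (D ⊗ D)) (k + k)                 ≡⟨ coef-⊕ (D ⊗ D) (X ⊗ (D ⊗ D)) (k + k) ⟩
  coef (D ⊗ D) (k + k) xor coef (X ⊗ (D ⊗ D)) (k + k) ≡⟨ cong₂ _xor_ (trans (at (square≈spread D) (k + k)) (coef-spread-even D k)) (odd-part k) ⟩
  coef D k xor false                                 ≡⟨ xor-identityʳ (coef D k) ⟩
  coef D k                                           ∎
  where
  open ≡-Reasoning
  expand : T ⊗ (D ⊗ D) ≈ D ⊗ D ⊕ X ⊗ (D ⊗ D)
  expand = solve 2 (λ x d → (con true :+ x) :* (d :* d) := d :* d :+ x :* (d :* d)) ≈-refl X D
  odd-part : ∀ k → coef (X ⊗ (D ⊗ D)) (k + k) ≡ false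
  odd-part zero    = coef-X⊗-zero (D ⊗ D)
  odd-part (suc k) rewrite +-suc k k =
    trans (coef-X⊗-suc (D ⊗ D) (suc (k + k))) (trans (at (square≈spread D) (suc (k + k))) (coef-spread-odd D k))

cancel-pair : ∀ {a b} c → a ≈ b → a ⊕ b ⊕ c ≈ c
cancel-pair c a≈b = ⊕-cong (≈⇒⊕≈[] a≈b) (≈-refl {c})

-- If (1 + x)·D² is divisible by x⁴, then x² divides D: the coefficients of
-- 1 and x² in (1 + x)·D(x²) are D(0) and D(1).
x⁴∣⇒x²∣ : ∀ D Y → X⁴ ⊗ Y ≈ T ⊗ (D ⊗ D) → D ≈ X ⊗ (X ⊗ tail (tail D))
x⁴∣⇒x²∣ D Y h = ≈-trans (divide-by-X D D₀≡0) (⊗-congʳ X (divide-by-X (tail D) D₁≡0))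
  where
  D₀≡0 : coef D 0 ≡ false
  D₀≡0 = trans (sym (coef-T⊗square D 0)) (trans (sym (at h 0)) (coef-X⁴⊗ Y 0 (s≤s z≤n)))
  D₁≡0 : coef (tail D) 0 ≡ false
  D₁≡0 = trans (coef-tail D 0) (trans (sym (coef-T⊗square D 1))
           (trans (sym (at h 2)) (coef-X⁴⊗ Y 2 (s≤s (s≤s (s≤s z≤n))))))

-- From P·(P + x²E) = (1 + x)·E²: the constant terms give P(0) = E(0), so
-- P = E + x·R, and expanding yields the descent equation for E and R.
reduced⇒descent : ∀ P E → P ⊗ (P ⊕ X ⊗ (X ⊗ E)) ≈ T ⊗ (E ⊗ E) → DescentEq E (tail (P ⊕ E))
reduced⇒descent P E h = X⊗-injective (begin
  X ⊗ (E ⊗ E)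
    ≈⟨ solve 3 (λ x e r → x :* (e :* e)
              := (x :* r :+ e) :* ((x :* r :+ e) :+ x :* (x :* e)) :+ (con true :+ x) :* (e :* e)
                 :+ x :* (x :* (r :* r :+ e :* e :+ x :* (e :* r)))) ≈-refl X E R ⟩
  (X ⊗ R ⊕ E) ⊗ ((X ⊗ R ⊕ E) ⊕ X ⊗ (X ⊗ E)) ⊕ T ⊗ (E ⊗ E) ⊕ X ⊗ (X ⊗ S)
    ≈⟨ cancel-pair (X ⊗ (X ⊗ S)) (≈-trans (⊗-cong (≈-sym P≈) (⊕-cong (≈-sym P≈) (≈-refl {X ⊗ (X ⊗ E)}))) h) ⟩
  X ⊗ (X ⊗ S) ∎)
  where
  open ≈-Reasoning
  R : Poly
  R = tail (P ⊕ E)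
  S : Poly
  S = R ⊗ R ⊕ E ⊗ E ⊕ X ⊗ (E ⊗ R)
  lhs₀ : coef (P ⊗ (P ⊕ X ⊗ (X ⊗ E))) 0 ≡ coef P 0
  lhs₀ rewrite coef₀-⊗ P (P ⊕ X ⊗ (X ⊗ E)) | coef-⊕ P (X ⊗ (X ⊗ E)) 0 | coef-X⊗-zero (X ⊗ E)
             | xor-identityʳ (coef P 0) = ∧-idem (coef P 0)
  P₀≡E₀ : coef P 0 ≡ coef E 0
  P₀≡E₀ = trans (sym lhs₀) (trans (at h 0) (coef-T⊗square E 0))
  P≈ : P ≈ X ⊗ R ⊕ E
  P≈ = ≈-trans (solve 2 (λ p e → p := (p :+ e) :+ e) ≈-refl P E)
               (⊕-cong (divide-by-X (P ⊕ E) (trans (coef-⊕ P E 0) (trans (cong (_xor coef E 0) P₀≡E₀) (xor-same (coef E 0)))))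
                       (≈-refl {E}))

-- In the variable y = 1 + x the key equation has no solution with D ≠ 0:
-- from y⁴·P·(P + D) = (1 + y)·D² one gets D = y²E, then P·(P + y²E) = (1 + y)·E²,
-- and E = 0 by descent.
no-solution-at-1 : ∀ D P → X⁴ ⊗ (P ⊗ (P ⊕ D)) ≈ T ⊗ (D ⊗ D) → D ≈ []
no-solution-at-1 D P h = begin
  D                    ≈⟨ D≈X²E ⟩
  X ⊗ (X ⊗ E)          ≈⟨ ⊗-congʳ X (⊗-congʳ X (descent E (tail (P ⊕ E)) (reduced⇒descent P E reduced))) ⟩
  X ⊗ (X ⊗ [])         ≈⟨ ⊗-congʳ X (⊗-zeroʳ X) ⟩
  X ⊗ []               ≈⟨ ⊗-zeroʳ X ⟩
  []                   ∎
  where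
  open ≈-Reasoning
  E : Poly
  E = tail (tail D)
  D≈X²E : D ≈ X ⊗ (X ⊗ E)
  D≈X²E = x⁴∣⇒x²∣ D (P ⊗ (P ⊕ D)) h
  reduced : P ⊗ (P ⊕ X ⊗ (X ⊗ E)) ≈ T ⊗ (E ⊗ E)
  reduced = X⁴⊗-injective (begin
    X⁴ ⊗ (P ⊗ (P ⊕ X ⊗ (X ⊗ E)))  ≈⟨ ⊗-congʳ X⁴ (⊗-congʳ P (⊕-cong (≈-refl {P}) (≈-sym D≈X²E))) ⟩
    X⁴ ⊗ (P ⊗ (P ⊕ D))            ≈⟨ h ⟩
    T ⊗ (D ⊗ D)                   ≈⟨ ⊗-congʳ T (⊗-cong D≈X²E D≈X²E) ⟩
    T ⊗ ((X ⊗ (X ⊗ E)) ⊗ (X ⊗ (X ⊗ E)))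
      ≈⟨ solve 2 (λ x e → (con true :+ x) :* ((x :* (x :* e)) :* (x :* (x :* e)))
                          := x :* x :* x :* x :* ((con true :+ x) :* (e :* e))) ≈-refl X E ⟩
    X⁴ ⊗ (T ⊗ (E ⊗ E))            ∎)

no-solution : ∀ D P → (one ⊕ X⁴) ⊗ (P ⊗ (P ⊕ D)) ≈ X ⊗ (D ⊗ D) → coef D 0 ≡ false
no-solution D P h = trans (sym (eval₁-σ D)) (eval₁-≈[] (no-solution-at-1 (σ D) (σ P) substituted))
  where
  σ[1+X⁴] : σ (one ⊕ X⁴) ≈ X⁴
  σ[1+X⁴] = mk≈ λ { 0 → refl ; 1 → refl ; 2 → refl ; 3 → refl ; 4 → refl ; 5 → refl ; 6 → refl
                  ; (suc (suc (suc (suc (suc (suc (suc n))))))) → refl }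
  σX : σ X ≈ T
  σX = mk≈ λ { 0 → refl ; 1 → refl ; 2 → refl ; 3 → refl ; (suc (suc (suc (suc n)))) → refl }
  substituted : X⁴ ⊗ (σ P ⊗ (σ P ⊕ σ D)) ≈ T ⊗ (σ D ⊗ σ D)
  substituted = begin
    X⁴ ⊗ (σ P ⊗ (σ P ⊕ σ D))              ≈⟨ ⊗-cong (≈-sym σ[1+X⁴]) (⊗-congʳ (σ P) (≈-sym (σ-⊕ P D))) ⟩
    σ (one ⊕ X⁴) ⊗ (σ P ⊗ σ (P ⊕ D))      ≈⟨ ⊗-congʳ (σ (one ⊕ X⁴)) (≈-sym (σ-⊗ P (P ⊕ D))) ⟩
    σ (one ⊕ X⁴) ⊗ σ (P ⊗ (P ⊕ D))        ≈⟨ ≈-sym (σ-⊗ (one ⊕ X⁴) (P ⊗ (P ⊕ D))) ⟩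
    σ ((one ⊕ X⁴) ⊗ (P ⊗ (P ⊕ D)))        ≈⟨ σ-cong h ⟩
    σ (X ⊗ (D ⊗ D))                       ≈⟨ σ-⊗ X (D ⊗ D) ⟩
    σ X ⊗ σ (D ⊗ D)                       ≈⟨ ⊗-cong σX (σ-⊗ D D) ⟩
    T ⊗ (σ D ⊗ σ D)                       ∎
    where open ≈-Reasoning

corr : (ℕ → Bool) → ℕ → (ℕ → Bool) → ℕ → Bool
corr f zero    u n = false
corr f (suc L) u n = (f 0 ∧ u n) xor corr (λ i → f (suc i)) L u (suc n)

corr-snoc : ∀ f L u n → corr f (suc L) u n ≡ corr f L u n xor (f L ∧ u (n + L))
corr-snoc f zero    u n rewrite +-identityʳ n = xor-identityʳ _
corr-snoc f (suc L) u n rewrite corr-snoc (λ i → f (suc i)) L u (suc n) | +-suc n L =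
  sym (xor-assoc (f 0 ∧ u n) _ _)

corr-cong : ∀ f L u u′ n → (∀ j → j < L → u (n + j) ≡ u′ (n + j)) → corr f L u n ≡ corr f L u′ n
corr-cong f zero    u u′ n agree = refl
corr-cong f (suc L) u u′ n agree = cong₂ _xor_
  (cong (f 0 ∧_) (subst (λ k → u k ≡ u′ k) (+-identityʳ n) (agree 0 (s≤s z≤n))))
  (corr-cong (λ i → f (suc i)) L u u′ (suc n) λ j j<L → subst (λ k → u k ≡ u′ k) (+-suc n j) (agree (suc j) (s≤s j<L)))

linSum≡corr : ∀ L c f u n → (∀ i → c i ≡ f (toℕ i)) → linSum L c u n ≡ corr f L u n
linSum≡corr zero    c f u n c≡f = refl
linSum≡corr (suc L) c f u n c≡f = cong₂ _xor_ (cong (_∧ u n) (c≡f Fin.zero))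
  (linSum≡corr L (λ i → c (Fin.suc i)) (λ i → f (suc i)) u (suc n) λ i → c≡f (Fin.suc i))

-- These are exactly the recurrences of Defs, with f(ℓ) the coefficient of u(n+ℓ).
record Annihilator (u : ℕ → Bool) (N ℓ : ℕ) (f : ℕ → Bool) : Set where
  field
    leading     : f ℓ ≡ true
    annihilates : ∀ n → n + ℓ < N → corr f (suc ℓ) u n ≡ false

xor≡false⇒≡ : ∀ {a b} → a xor b ≡ false → a ≡ b
xor≡false⇒≡ {false} {false} _ = refl
xor≡false⇒≡ {true}  {true}  _ = refl

annihilator⇒recurrence : ∀ {u N ℓ f} → Annihilator u N ℓ f → HasRecurrence u N ℓ
annihilator⇒recurrence {u} {N} {ℓ} {f} ann = (λ i → f (toℕ i)) , λ n n+ℓ<N →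
  sym (trans (linSum≡corr ℓ _ f u n (λ _ → refl)) (xor≡false⇒≡ (begin
    corr f ℓ u n xor u (n + ℓ)           ≡⟨ cong (corr f ℓ u n xor_) (sym (cong (_∧ u (n + ℓ)) leading)) ⟩
    corr f ℓ u n xor (f ℓ ∧ u (n + ℓ))   ≡⟨ sym (corr-snoc f ℓ u n) ⟩
    corr f (suc ℓ) u n                   ≡⟨ annihilates n n+ℓ<N ⟩
    false                                ∎)))
  where
  open Annihilator ann
  open ≡-Reasoning

extend : ∀ ℓ → (Fin ℓ → Bool) → ℕ → Bool
extend zero    c i       = true
extend (suc ℓ) c zero    = c Fin.zero
extend (suc ℓ) c (suc i) = extend ℓ (λ j → c (Fin.suc j)) i

extend-toℕ : ∀ ℓ c i → c i ≡ extend ℓ c (toℕ i)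
extend-toℕ (suc ℓ) c Fin.zero    = refl
extend-toℕ (suc ℓ) c (Fin.suc i) = extend-toℕ ℓ (λ j → c (Fin.suc j)) i

extend-leading : ∀ ℓ c → extend ℓ c ℓ ≡ true
extend-leading zero    c = refl
extend-leading (suc ℓ) c = extend-leading ℓ (λ j → c (Fin.suc j))

recurrence⇒annihilator : ∀ {u N ℓ} → HasRecurrence u N ℓ → Σ (ℕ → Bool) (Annihilator u N ℓ)
recurrence⇒annihilator {u} {N} {ℓ} (c , rec) = extend ℓ c , record
  { leading     = extend-leading ℓ c
  ; annihilates = λ n n+ℓ<N → begin
      corr f (suc ℓ) u n                   ≡⟨ corr-snoc f ℓ u n ⟩
      corr f ℓ u n xor (f ℓ ∧ u (n + ℓ))   ≡⟨ cong₂ (λ a b → a xor (b ∧ u (n + ℓ))) (sym (linSum≡corr ℓ c f u n (extend-toℕ ℓ c))) (extend-leading ℓ c) ⟩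
      linSum ℓ c u n xor u (n + ℓ)         ≡⟨ cong (_xor u (n + ℓ)) (sym (rec n n+ℓ<N)) ⟩
      u (n + ℓ) xor u (n + ℓ)              ≡⟨ xor-same (u (n + ℓ)) ⟩
      false                                ∎ }
  where
  f : ℕ → Bool
  f = extend ℓ c
  open ≡-Reasoning

prefix : ℕ → (ℕ → Bool) → Poly
prefix zero    u = []
prefix (suc N) u = u 0 ∷ prefix N (λ i → u (suc i))

coef-prefix : ∀ N u m → m < N → coef (prefix N u) m ≡ u m
coef-prefix (suc N) u zero    _         = refl
coef-prefix (suc N) u (suc m) (s≤s m<N) = coef-prefix N (λ i → u (suc i)) m m<N

deg<-prefix : ∀ N u → prefix N u deg< N
deg<-prefix zero    u = mk-deg< λ _ _ → refl
deg<-prefix (suc N) u = mk-deg< λ { zero () ; (suc m) (s≤s N≤m) → vanishes (deg<-prefix N (λ i → u (suc i))) m N≤m }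

reciprocal : ℕ → (ℕ → Bool) → Poly
reciprocal zero    f = cst (f 0)
reciprocal (suc ℓ) f = f (suc ℓ) ∷ reciprocal ℓ f

coef₀-reciprocal : ∀ ℓ f → coef (reciprocal ℓ f) 0 ≡ f ℓ
coef₀-reciprocal zero    f = refl
coef₀-reciprocal (suc ℓ) f = refl

deg<-reciprocal : ∀ ℓ f → reciprocal ℓ f deg< suc ℓ
deg<-reciprocal zero    f = mk-deg< λ { zero () ; (suc m) _ → refl }
deg<-reciprocal (suc ℓ) f = mk-deg< λ { zero () ; (suc m) (s≤s ℓ<m) → vanishes (deg<-reciprocal ℓ f) m ℓ<m }

coef-reciprocal-⊗ : ∀ ℓ f G n → coef (reciprocal ℓ f ⊗ G) (n + ℓ) ≡ corr f (suc ℓ) (coef G) n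
coef-reciprocal-⊗ zero f G n rewrite +-identityʳ n =
  trans (coef-⊕ (scale (f 0) G) (x* []) n) (cong₂ _xor_ (coef-scale (f 0) G n) (at x*-zero n))
coef-reciprocal-⊗ (suc ℓ) f G n = begin
  coef (scale (f (suc ℓ)) G ⊕ x* (reciprocal ℓ f ⊗ G)) (n + suc ℓ)
    ≡⟨ cong (coef (scale (f (suc ℓ)) G ⊕ x* (reciprocal ℓ f ⊗ G))) (+-suc n ℓ) ⟩
  coef (scale (f (suc ℓ)) G ⊕ x* (reciprocal ℓ f ⊗ G)) (suc (n + ℓ))
    ≡⟨ coef-⊕ (scale (f (suc ℓ)) G) (x* (reciprocal ℓ f ⊗ G)) (suc (n + ℓ)) ⟩
  coef (scale (f (suc ℓ)) G) (suc (n + ℓ)) xor coef (reciprocal ℓ f ⊗ G) (n + ℓ)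
    ≡⟨ cong₂ _xor_ (trans (coef-scale (f (suc ℓ)) G (suc (n + ℓ))) (cong (λ k → f (suc ℓ) ∧ coef G k) (sym (+-suc n ℓ))))
                   (coef-reciprocal-⊗ ℓ f G n) ⟩
  (f (suc ℓ) ∧ coef G (n + suc ℓ)) xor corr f (suc ℓ) (coef G) n
    ≡⟨ xor-comm (f (suc ℓ) ∧ coef G (n + suc ℓ)) (corr f (suc ℓ) (coef G) n) ⟩
  corr f (suc ℓ) (coef G) n xor (f (suc ℓ) ∧ coef G (n + suc ℓ))
    ≡⟨ sym (corr-snoc f (suc ℓ) (coef G) n) ⟩
  corr f (suc (suc ℓ)) (coef G) n ∎
  where open ≡-Reasoning

PaperfoldingEq : (ℕ → Bool) → ℕ → Set
PaperfoldingEq u N = (one ⊕ X⁴) ⊗ (G ⊗ G ⊕ G) ≈ X mod N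
  where
  G : Poly
  G = prefix N u

reciprocal⊗prefix : ∀ u N ℓ f → Annihilator u N ℓ f →
  reciprocal ℓ f ⊗ prefix N u ≈ prefix ℓ (coef (reciprocal ℓ f ⊗ prefix N u)) mod N
reciprocal⊗prefix u N ℓ f ann = mk≈mod λ m m<N → compare m m<N (ℓ ≤? m)
  where
  D⊗G : Poly
  D⊗G = reciprocal ℓ f ⊗ prefix N u
  vanish : ∀ n → n + ℓ < N → coef D⊗G (n + ℓ) ≡ false
  vanish n n+ℓ<N = begin
    coef D⊗G (n + ℓ)                     ≡⟨ coef-reciprocal-⊗ ℓ f (prefix N u) n ⟩
    corr f (suc ℓ) (coef (prefix N u)) n ≡⟨ corr-cong f (suc ℓ) _ u n (λ j j≤ℓ → coef-prefix N u (n + j)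
                                              (≤-<-trans (+-monoʳ-≤ n (≤-pred j≤ℓ)) n+ℓ<N)) ⟩
    corr f (suc ℓ) u n                   ≡⟨ Annihilator.annihilates ann n n+ℓ<N ⟩
    false                                ∎
    where open ≡-Reasoning
  compare : ∀ m → m < N → Dec (ℓ ≤ m) → coef D⊗G m ≡ coef (prefix ℓ (coef D⊗G)) m
  compare m m<N (no  ℓ≰m) = sym (coef-prefix ℓ (coef D⊗G) m (≰⇒> ℓ≰m))
  compare m m<N (yes ℓ≤m) = trans
    (subst (λ k → coef D⊗G k ≡ false) (m∸n+n≡m ℓ≤m) (vanish (m ∸ ℓ) (subst (_< N) (sym (m∸n+n≡m ℓ≤m)) m<N)))
    (sym (vanishes (deg<-prefix ℓ (coef D⊗G)) m ℓ≤m))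

-- An annihilator of length ℓ with 2ℓ + 4 ≤ N would give polynomials
-- P, D = f* with D(0) = 1 and (1 + x⁴)·P·(P + D) ≡ x·D² (mod x^N); both sides
-- have degree < N, so they are equal, contradicting no-solution.
no-short-annihilator : ∀ u N ℓ f → PaperfoldingEq u N → Annihilator u N ℓ f → 4 + (ℓ + ℓ) ≤ N → ⊥
no-short-annihilator u N ℓ f eq ann big = true≢false (trans (sym leading-one) (no-solution D P exact))
  where
  true≢false : true ≡ false → ⊥
  true≢false ()
  G : Poly
  G = prefix N u
  D : Poly
  D = reciprocal ℓ f
  P : Poly
  P = prefix ℓ (coef (D ⊗ G))
  leading-one : coef D 0 ≡ true
  leading-one = trans (coef₀-reciprocal ℓ f) (Annihilator.leading ann)
  D⊗G≈P : D ⊗ G ≈ P mod N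
  D⊗G≈P = reciprocal⊗prefix u N ℓ f ann
  congruent : (one ⊕ X⁴) ⊗ (P ⊗ (P ⊕ D)) ≈ X ⊗ (D ⊗ D) mod N
  congruent = begin
    (one ⊕ X⁴) ⊗ (P ⊗ (P ⊕ D))
      ≈⟨ ⊗-congʳ-mod (one ⊕ X⁴) (⊗-cong-mod (≈mod-sym D⊗G≈P) (⊕-cong-mod (≈mod-sym D⊗G≈P) (≈⇒≈mod (≈-refl {D})))) ⟩
    (one ⊕ X⁴) ⊗ ((D ⊗ G) ⊗ (D ⊗ G ⊕ D))
      ≈⟨ ≈⇒≈mod (solve 3 (λ q d g → q :* ((d :* g) :* (d :* g :+ d)) := (d :* d) :* (q :* (g :* g :+ g))) ≈-refl (one ⊕ X⁴) D G) ⟩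
    (D ⊗ D) ⊗ ((one ⊕ X⁴) ⊗ (G ⊗ G ⊕ G))
      ≈⟨ ⊗-congʳ-mod (D ⊗ D) eq ⟩
    (D ⊗ D) ⊗ X
      ≈⟨ ≈⇒≈mod (⊗-comm (D ⊗ D) X) ⟩
    X ⊗ (D ⊗ D) ∎
    where open ≈mod-Reasoning N
  deg-lhs : (one ⊕ X⁴) ⊗ (P ⊗ (P ⊕ D)) deg< 4 + (ℓ + ℓ)
  deg-lhs = deg<-⊗ deg<-1+X⁴
                   (deg<-≈ (⊗-comm (P ⊕ D) P)
                     (deg<-⊗ (deg<-⊕ (deg<-mono (n≤1+n ℓ) (deg<-prefix ℓ (coef (D ⊗ G)))) (deg<-reciprocal ℓ f))
                             (deg<-prefix ℓ (coef (D ⊗ G)))))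
  deg-rhs : X ⊗ (D ⊗ D) deg< 1 + (ℓ + suc ℓ)
  deg-rhs = deg<-⊗ deg<-X (deg<-⊗ (deg<-reciprocal ℓ f) (deg<-reciprocal ℓ f))
  rhs-fits : 1 + (ℓ + suc ℓ) ≤ N
  rhs-fits = ≤-trans (≤-reflexive (cong suc (+-suc ℓ ℓ))) (≤-trans (s≤s (s≤s (m≤n+m (ℓ + ℓ) 2))) big)
  exact : (one ⊕ X⁴) ⊗ (P ⊗ (P ⊕ D)) ≈ X ⊗ (D ⊗ D)
  exact = ≈mod⇒≈ congruent (deg<-mono big deg-lhs) (deg<-mono rhs-fits deg-rhs)

lower-bound : ∀ u N ℓ f → PaperfoldingEq u N → Annihilator u N ℓ f → N ≤ 2 * ℓ + 3
lower-bound u N ℓ f eq ann with 4 + (ℓ + ℓ) ≤? N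
... | yes big   = ⊥-elim (no-short-annihilator u N ℓ f eq ann big)
... | no  small = subst (N ≤_) (3+[ℓ+ℓ]≡2*ℓ+3 ℓ) (≤-pred (≰⇒> small))
  where
  3+[ℓ+ℓ]≡2*ℓ+3 : ∀ ℓ → 3 + (ℓ + ℓ) ≡ 2 * ℓ + 3
  3+[ℓ+ℓ]≡2*ℓ+3 = solve-∀

complexity≤length : ∀ {u N L ℓ} → IsLinearComplexity u N L → HasRecurrence u N ℓ → L ≤ ℓ
complexity≤length {L = L} {ℓ} (_ , minimal) rec with L ≤? ℓ
... | yes L≤ℓ = L≤ℓ
... | no  L≰ℓ = ⊥-elim (minimal ℓ (≰⇒> L≰ℓ) rec)

data Parity : ℕ → Set where
  even : ∀ k → Parity (k + k)
  odd  : ∀ k → Parity (suc (k + k))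

parity : ∀ m → Parity m
parity zero    = even 0
parity (suc m) with parity m
... | even k = odd k
... | odd  k = subst Parity (cong suc (+-suc k k)) (even (suc k))

-- χ(m) = 1 iff m ≡ 1 (mod 4): the coefficients of x/(1 + x⁴) = x + x⁵ + x⁹ + ⋯.
χ : ℕ → Bool
χ 0 = false
χ 1 = true
χ 2 = false
χ 3 = false
χ (suc (suc (suc (suc m)))) = χ m

χ-mod4 : ∀ m → (m % 4 ≡ᵇ 1) ≡ χ m
χ-mod4 0 = refl
χ-mod4 1 = refl
χ-mod4 2 = refl
χ-mod4 3 = refl
χ-mod4 (suc (suc (suc (suc m)))) =
  trans (cong (λ k → k % 4 ≡ᵇ 1) (+-comm 4 m)) (trans (cong (_≡ᵇ 1) ([m+n]%n≡m%n m 4)) (χ-mod4 m))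

χ-even : ∀ k → χ (k + k) ≡ false
χ-even zero          = refl
χ-even (suc zero)    = refl
χ-even (suc (suc k)) rewrite +-suc k (suc k) | +-suc k k = χ-even k

-- If u(2k) = u(k) and u(2k+1) = χ(2k+1), the generating polynomial G of the
-- first N terms satisfies G² + G ≡ Σ χ(m)xᵐ, hence (1 + x⁴)(G² + G) ≡ x (mod x^N).
paperfolding-congruence : ∀ u → (∀ k → u (k + k) ≡ u k) → (∀ k → u (suc (k + k)) ≡ χ (suc (k + k))) →
  ∀ N → PaperfoldingEq u N
paperfolding-congruence u u-even u-odd N = mk≈mod λ m m<N → trans (at expand m) (trans (coef-⊕ Y (X⁴ ⊗ Y) m) (coefficient m m<N))
  where
  G : Poly
  G = prefix N u
  Y : Poly
  Y = G ⊗ G ⊕ G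
  expand : (one ⊕ X⁴) ⊗ Y ≈ Y ⊕ X⁴ ⊗ Y
  expand = solve 2 (λ q y → (con true :+ q) :* y := y :+ q :* y) ≈-refl X⁴ Y
  coef-Y : ∀ m → m < N → coef Y m ≡ χ m
  coef-Y m m<N = trans (coef-⊕ (G ⊗ G) G m) (trans (cong (_xor coef G m) (at (square≈spread G) m)) (by-parity m m<N (parity m)))
    where
    by-parity : ∀ m → m < N → Parity m → coef (spread G) m xor coef G m ≡ χ m
    by-parity .(k + k) m<N (even k) = begin
      coef (spread G) (k + k) xor coef G (k + k) ≡⟨ cong₂ _xor_ (trans (coef-spread-even G k) (coef-prefix N u k (≤-<-trans (m≤m+n k k) m<N)))
                                                             (trans (coef-prefix N u (k + k) m<N) (u-even k)) ⟩
      u k xor u k                                ≡⟨ xor-same (u k) ⟩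
      false                                      ≡⟨ sym (χ-even k) ⟩
      χ (k + k)                                  ∎
      where open ≡-Reasoning
    by-parity .(suc (k + k)) m<N (odd k) =
      cong₂ _xor_ (coef-spread-odd G k) (trans (coef-prefix N u (suc (k + k)) m<N) (u-odd k))
  coefficient : ∀ m → m < N → coef Y m xor coef (X⁴ ⊗ Y) m ≡ coef X m
  coefficient 0 m<N = trans (cong₂ _xor_ (coef-Y 0 m<N) (coef-X⁴⊗ Y 0 (s≤s z≤n))) refl
  coefficient 1 m<N = trans (cong₂ _xor_ (coef-Y 1 m<N) (coef-X⁴⊗ Y 1 (s≤s (s≤s z≤n)))) refl
  coefficient 2 m<N = trans (cong₂ _xor_ (coef-Y 2 m<N) (coef-X⁴⊗ Y 2 (s≤s (s≤s (s≤s z≤n))))) refl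
  coefficient 3 m<N = trans (cong₂ _xor_ (coef-Y 3 m<N) (coef-X⁴⊗ Y 3 (s≤s (s≤s (s≤s (s≤s z≤n)))))) refl
  coefficient (suc (suc (suc (suc j)))) m<N =
    trans (cong₂ _xor_ (coef-Y (4 + j) m<N) (trans (coef-X⁴⊗-shift Y j) (coef-Y j (≤-<-trans (m≤n+m j 4) m<N))))
          (xor-same (χ j))

IsPaperfolding : (ℕ → Bool) → Set
IsPaperfolding v = ∀ m k → m % 2 ≡ 1 → v (m * 2 ^ k) ≡ (m % 4 ≡ᵇ 1)

odd-mod2 : ∀ k → suc (k + k) % 2 ≡ 1
odd-mod2 k = trans (cong (_% 2) (2k+1≡1+k*2 k)) ([m+kn]%n≡m%n 1 k 2)
  where
  2k+1≡1+k*2 : ∀ k → suc (k + k) ≡ 1 + k * 2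
  2k+1≡1+k*2 = solve-∀

OddPart : ℕ → Set
OddPart n = Σ ℕ λ m → Σ ℕ λ j → (m % 2 ≡ 1) × (n ≡ m * 2 ^ j)

double-odd-part : ∀ m j → m * 2 ^ j + m * 2 ^ j ≡ m * 2 ^ suc j
double-odd-part m j = double m (2 ^ j)
  where
  double : ∀ m x → m * x + m * x ≡ m * (2 * x)
  double = solve-∀

odd-part : ∀ n → 0 < n → OddPart n
odd-part = <-rec (λ n → 0 < n → OddPart n) go
  where
  go : ∀ n → (∀ {k} → k < n → 0 < k → OddPart k) → 0 < n → OddPart n
  go n rec pos with parity n
  ... | odd k         = suc (k + k) , 0 , odd-mod2 k , sym (*-identityʳ (suc (k + k)))
  ... | even (suc k) with rec (s≤s (m≤n+m (suc k) k)) (s≤s z≤n)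
  ...   | m , j , m-odd , e = m , suc j , m-odd , trans (cong₂ _+_ e e) (double-odd-part m j)

paperfolding-odd : ∀ {v} → IsPaperfolding v → ∀ k → v (suc (k + k)) ≡ χ (suc (k + k))
paperfolding-odd {v} H k =
  trans (cong v (sym (*-identityʳ (suc (k + k))))) (trans (H (suc (k + k)) 0 (odd-mod2 k)) (χ-mod4 (suc (k + k))))

paperfolding-double : ∀ {v} → IsPaperfolding v → ∀ k → v (k + k) ≡ v k
paperfolding-double     H zero = refl
paperfolding-double {v} H (suc k) with odd-part (suc k) (s≤s z≤n)
... | m , j , m-odd , e = begin
  v (suc k + suc k) ≡⟨ cong v (trans (cong₂ _+_ e e) (double-odd-part m j)) ⟩
  v (m * 2 ^ suc j) ≡⟨ H m (suc j) m-odd ⟩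
  (m % 4 ≡ᵇ 1)      ≡⟨ sym (H m j m-odd) ⟩
  v (m * 2 ^ j)     ≡⟨ cong v (sym e) ⟩
  v (suc k)         ∎
  where open ≡-Reasoning

paperfolding-eq : ∀ {v} → IsPaperfolding v → ∀ N → PaperfoldingEq v N
paperfolding-eq {v} H = paperfolding-congruence v (paperfolding-double {v} H) (paperfolding-odd {v} H)

-- v(1) = 1, which starts the Berlekamp–Massey construction when v(0) = 0.
paperfolding-one : ∀ {v} → IsPaperfolding v → v 1 ≡ true
paperfolding-one {v} H = paperfolding-odd {v} H 0

_⊞_ : (ℕ → Bool) → (ℕ → Bool) → ℕ → Bool
(f ⊞ g) i = f i xor g i

corr-⊞ : ∀ f g L u n → corr (f ⊞ g) L u n ≡ corr f L u n xor corr g L u n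
corr-⊞ f g zero    u n = refl
corr-⊞ f g (suc L) u n = trans
  (cong₂ _xor_ (∧-distribʳ-xor (u n) (f 0) (g 0)) (corr-⊞ (λ i → f (suc i)) (λ i → g (suc i)) L u (suc n)))
  (xor-interchange (f 0 ∧ u n) (g 0 ∧ u n) _ _)

corr-pad : ∀ f L k u n → (∀ i → L ≤ i → f i ≡ false) → corr f (k + L) u n ≡ corr f L u n
corr-pad f L zero    u n f≡0 = refl
corr-pad f L (suc k) u n f≡0 = begin
  corr f (suc (k + L)) u n                              ≡⟨ corr-snoc f (k + L) u n ⟩
  corr f (k + L) u n xor (f (k + L) ∧ u (n + (k + L)))  ≡⟨ cong₂ (λ a b → a xor (b ∧ u (n + (k + L)))) (corr-pad f L k u n f≡0) (f≡0 (k + L) (m≤n+m L k)) ⟩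
  corr f L u n xor false                                ≡⟨ xor-identityʳ _ ⟩
  corr f L u n                                          ∎
  where open ≡-Reasoning

shiftBy : ℕ → (ℕ → Bool) → ℕ → Bool
shiftBy zero    g i       = g i
shiftBy (suc s) g zero    = false
shiftBy (suc s) g (suc i) = shiftBy s g i

shiftBy-at : ∀ s g i → shiftBy s g (s + i) ≡ g i
shiftBy-at zero    g i = refl
shiftBy-at (suc s) g i = shiftBy-at s g i

shiftBy-above : ∀ s g b → (∀ i → b < i → g i ≡ false) → ∀ i → s + b < i → shiftBy s g i ≡ false
shiftBy-above zero    g b g≡0 i       b<i       = g≡0 i b<i
shiftBy-above (suc s) g b g≡0 (suc i) (s≤s s+b<i) = shiftBy-above s g b g≡0 i s+b<i

corr-shiftBy : ∀ s g L u n → corr (shiftBy s g) (s + L) u n ≡ corr g L u (n + s)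
corr-shiftBy zero    g L u n = cong (corr g L u) (sym (+-identityʳ n))
corr-shiftBy (suc s) g L u n = trans (corr-shiftBy s g L u (suc n)) (cong (corr g L u) (sym (+-suc n s)))

corr-shifted : ∀ s g b M u n → s + b ≤ M → (∀ i → b < i → g i ≡ false) →
  corr (shiftBy s g) (suc M) u n ≡ corr g (suc b) u (n + s)
corr-shifted s g b M u n s+b≤M g≡0 = begin
  corr (shiftBy s g) (suc M) u n                            ≡⟨ cong (λ L → corr (shiftBy s g) L u n) (sym window) ⟩
  corr (shiftBy s g) ((M ∸ (s + b)) + (s + suc b)) u n      ≡⟨ corr-pad (shiftBy s g) (s + suc b) (M ∸ (s + b)) u n
                                                                  (λ i s+b<i → shiftBy-above s g b g≡0 i (subst (_≤ i) (+-suc s b) s+b<i)) ⟩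
  corr (shiftBy s g) (s + suc b) u n                        ≡⟨ corr-shiftBy s g (suc b) u n ⟩
  corr g (suc b) u (n + s)                                  ∎
  where
  open ≡-Reasoning
  window : (M ∸ (s + b)) + (s + suc b) ≡ suc M
  window = trans (cong ((M ∸ (s + b)) +_) (+-suc s b)) (trans (+-suc (M ∸ (s + b)) (s + b)) (cong suc (m∸n+n≡m s+b≤M)))

record FailsAt (u : ℕ → Bool) (a p : ℕ) (f : ℕ → Bool) : Set where
  field
    vanishes-above : ∀ i → a < i → f i ≡ false
    holds-before   : ∀ n → n < p → corr f (suc a) u n ≡ false
    fails          : corr f (suc a) u p ≡ true

-- Massey's combination: if f and g fail at p = c + s and q = c + t, then
-- x^s·f + x^t·g annihilates u at every n ≤ c (the two failures cancel at c).
combine : ∀ {u a b p q f g} s t c M → FailsAt u a p f → FailsAt u b q g →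
  s + a ≤ M → t + b ≤ M → c + s ≡ p → c + t ≡ q →
  ∀ n → n ≤ c → corr (shiftBy s f ⊞ shiftBy t g) (suc M) u n ≡ false
combine {u} {a} {b} {p} {q} {f} {g} s t c M F G s+a≤M t+b≤M c+s≡p c+t≡q n n≤c =
  trans (corr-⊞ (shiftBy s f) (shiftBy t g) (suc M) u n)
  (trans (cong₂ _xor_ (corr-shifted s f a M u n s+a≤M (FailsAt.vanishes-above F))
                      (corr-shifted t g b M u n t+b≤M (FailsAt.vanishes-above G)))
         (cases (m≤n⇒m<n∨m≡n n≤c)))
  where
  cases : _ → corr f (suc a) u (n + s) xor corr g (suc b) u (n + t) ≡ false
  cases (inj₁ n<c)  = cong₂ _xor_ (FailsAt.holds-before F (n + s) (subst (n + s <_) c+s≡p (+-monoˡ-< s n<c)))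
                                  (FailsAt.holds-before G (n + t) (subst (n + t <_) c+t≡q (+-monoˡ-< t n<c)))
  cases (inj₂ refl) = cong₂ _xor_ (trans (cong (corr f (suc a) u) c+s≡p) (FailsAt.fails F))
                                  (trans (cong (corr g (suc b) u) c+t≡q) (FailsAt.fails G))

no-room : ∀ n L → n + L < L → ⊥
no-room n L lt = <-irrefl refl (≤-trans lt (m≤n+m L n))

unit : ℕ → ℕ → Bool
unit k i = i ≡ᵇ k

unit-at : ∀ k → unit k k ≡ true
unit-at zero    = refl
unit-at (suc k) = unit-at k

unit-above : ∀ k i → k < i → unit k i ≡ false
unit-above zero    (suc i) _         = refl
unit-above (suc k) (suc i) (s≤s k<i) = unit-above k i k<i

-- The Berlekamp–Massey construction, run on a sequence u with u(1) = 1 whose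
-- annihilators obey the lower bound N ≤ 2ℓ + 3: every time the length must
-- grow, the lower bound applied to the old annihilator caps the new length,
-- so 2ℓ ≤ N + 4 holds for the annihilator produced after N terms.
module Construction (u : ℕ → Bool) (u₁≡1 : u 1 ≡ true)
                    (lower : ∀ N ℓ f → Annihilator u N ℓ f → N ≤ 2 * ℓ + 3) where

  -- The invariant after reading N terms: f is the current annihilator, of
  -- length 1 + d, with N = k + (1 + d); g is the previous one, of length
  -- ℓ′ ≤ k, which annihilates the windows starting before d and fails on the
  -- window starting at d.
  record State (N : ℕ) : Set where
    field
      d ℓ′ k    : ℕ
      f g       : ℕ → Bool
      N≡k+1+d   : N ≡ k + suc d
      ℓ′≤k      : ℓ′ ≤ k
      f-ann     : Annihilator u N (suc d) f
      f-above   : ∀ i → suc d < i → f i ≡ false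
      g-fails   : FailsAt u ℓ′ d g
      bound     : 2 * suc d ≤ N + 4

  discrepancy : ∀ {N} → State N → Bool
  discrepancy st = corr f (suc (suc d)) u k
    where open State st

  within : ∀ {n k L} → n + L < suc (k + L) → n ≤ k
  within {n} {k} {L} lt = +-cancelʳ-≤ L n k (≤-pred lt)

  valid-before : ∀ {N} (st : State N) → ∀ n → n < State.k st → corr (State.f st) (suc (suc (State.d st))) u n ≡ false
  valid-before st n n<k = Annihilator.annihilates f-ann n (subst (n + suc d <_) (sym N≡k+1+d) (+-monoˡ-< (suc d) n<k))
    where open State st

  current-fails : ∀ {N} (st : State N) → discrepancy st ≡ true → FailsAt u (suc (State.d st)) (State.k st) (State.f st)
  current-fails st δ≡1 = record
    { vanishes-above = State.f-above st ; holds-before = valid-before st ; fails = δ≡1 }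

  keep : ∀ {N} (st : State N) → discrepancy st ≡ false → State (suc N)
  keep {N} st δ≡0 = record
    { d = d ; ℓ′ = ℓ′ ; k = suc k ; f = f ; g = g
    ; N≡k+1+d = cong suc N≡k+1+d
    ; ℓ′≤k    = m≤n⇒m≤1+n ℓ′≤k
    ; f-ann   = record { leading = Annihilator.leading f-ann ; annihilates = valid }
    ; f-above = f-above
    ; g-fails = g-fails
    ; bound   = m≤n⇒m≤1+n bound
    }
    where
    open State st
    valid : ∀ n → n + suc d < suc N → corr f (suc (suc d)) u n ≡ false
    valid n lt with m≤n⇒m<n∨m≡n (within (subst (λ M → n + suc d < suc M) N≡k+1+d lt))
    ... | inj₁ n<k  = valid-before st n n<k
    ... | inj₂ refl = δ≡0

  adjust : ∀ {N} (st : State N) → discrepancy st ≡ true → State.k st ≤ State.d st → State (suc N)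
  adjust {N} st δ≡1 k≤d = record
    { d = d ; ℓ′ = ℓ′ ; k = suc k ; f = f′ ; g = g
    ; N≡k+1+d = cong suc N≡k+1+d
    ; ℓ′≤k    = m≤n⇒m≤1+n ℓ′≤k
    ; f-ann   = record { leading = leading′ ; annihilates = valid }
    ; f-above = λ i 1+d<i → cong₂ _xor_ (f-above i 1+d<i) (g′-above i (≤-trans (s≤s (m≤n⇒m≤1+n s+ℓ′≤d)) 1+d<i))
    ; g-fails = g-fails
    ; bound   = m≤n⇒m≤1+n bound
    }
    where
    open State st
    s : ℕ
    s = d ∸ k
    f′ : ℕ → Bool
    f′ = f ⊞ shiftBy s g
    s+ℓ′≤d : s + ℓ′ ≤ d
    s+ℓ′≤d = ≤-trans (+-monoʳ-≤ s ℓ′≤k) (≤-reflexive (m∸n+n≡m k≤d))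
    g′-above : ∀ i → s + ℓ′ < i → shiftBy s g i ≡ false
    g′-above = shiftBy-above s g ℓ′ (FailsAt.vanishes-above g-fails)
    leading′ : f′ (suc d) ≡ true
    leading′ = cong₂ _xor_ (Annihilator.leading f-ann) (g′-above (suc d) (s≤s s+ℓ′≤d))
    valid : ∀ n → n + suc d < suc N → corr f′ (suc (suc d)) u n ≡ false
    valid n lt = combine 0 s k (suc d) (current-fails st δ≡1) g-fails ≤-refl (m≤n⇒m≤1+n s+ℓ′≤d)
                   (+-identityʳ k) (m+[n∸m]≡n k≤d) n (within (subst (λ M → n + suc d < suc M) N≡k+1+d lt))

  lengthen-bound : ∀ k d → k + suc d ≤ 2 * suc d + 3 → 2 * suc k ≤ suc (k + suc d) + 4
  lengthen-bound k d h = subst₂ _≤_ (e₁ k) (e₂ k d) (s≤s (+-monoʳ-≤ k (s≤s k≤d+4)))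
    where
    e₁ : ∀ k → suc (k + suc k) ≡ 2 * suc k
    e₁ = solve-∀
    e₂ : ∀ k d → suc (k + suc (d + 4)) ≡ suc (k + suc d) + 4
    e₂ = solve-∀
    e₃ : ∀ d → 2 * suc d + 3 ≡ d + 4 + suc d
    e₃ = solve-∀
    k≤d+4 : k ≤ d + 4
    k≤d+4 = +-cancelʳ-≤ (suc d) k (d + 4) (subst (k + suc d ≤_) (e₃ d) h)

  lengthen : ∀ {N} (st : State N) → discrepancy st ≡ true → State.d st < State.k st → State (suc N)
  lengthen {N} st δ≡1 d<k = record
    { d = k ; ℓ′ = suc d ; k = suc d ; f = f′ ; g = f
    ; N≡k+1+d = cong suc (trans N≡k+1+d (swap k d))
    ; ℓ′≤k    = ≤-refl
    ; f-ann   = record { leading = leading′ ; annihilates = valid }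
    ; f-above = λ i 1+k<i → cong₂ _xor_ (shiftBy-above t f (suc d) f-above i (subst (_< i) (sym t+1+d≡1+k) 1+k<i))
                                       (FailsAt.vanishes-above g-fails i (≤-trans (s≤s (m≤n⇒m≤1+n ℓ′≤k)) 1+k<i))
    ; g-fails = current-fails st δ≡1
    ; bound   = subst (λ M → 2 * suc k ≤ suc M + 4) (sym N≡k+1+d)
                  (lengthen-bound k d (subst (_≤ 2 * suc d + 3) N≡k+1+d (lower N (suc d) f f-ann)))
    }
    where
    open State st
    t : ℕ
    t = k ∸ d
    f′ : ℕ → Bool
    f′ = shiftBy t f ⊞ g
    swap : ∀ k d → k + suc d ≡ d + suc k
    swap = solve-∀
    t+1+d≡1+k : t + suc d ≡ suc k
    t+1+d≡1+k = trans (+-suc t d) (cong suc (m∸n+n≡m (<⇒≤ d<k)))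
    leading′ : f′ (suc k) ≡ true
    leading′ = cong₂ _xor_ (trans (cong (shiftBy t f) (sym t+1+d≡1+k)) (trans (shiftBy-at t f (suc d)) (Annihilator.leading f-ann)))
                           (FailsAt.vanishes-above g-fails (suc k) (s≤s ℓ′≤k))
    valid : ∀ n → n + suc k < suc N → corr f′ (suc (suc k)) u n ≡ false
    valid n lt = combine t 0 d (suc k) (current-fails st δ≡1) g-fails (≤-reflexive t+1+d≡1+k) (m≤n⇒m≤1+n ℓ′≤k)
                   (m+[n∸m]≡n (<⇒≤ d<k)) (+-identityʳ d) n
                   (within (subst (λ M → n + suc k < suc M) (trans N≡k+1+d (swap k d)) lt))

  step : ∀ {N} → State N → State (suc N)
  step st with discrepancy st in δ | State.k st ≤? State.d st
  ... | false | _        = keep st δ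
  ... | true  | yes k≤d  = adjust st δ k≤d
  ... | true  | no  k≰d  = lengthen st δ (≰⇒> k≰d)

  start-one : u 0 ≡ true → State 1
  start-one u₀≡1 = record
    { d = 0 ; ℓ′ = 0 ; k = 0 ; f = unit 1 ; g = unit 0
    ; N≡k+1+d = refl
    ; ℓ′≤k    = z≤n
    ; f-ann   = record { leading = refl ; annihilates = λ n lt → ⊥-elim (no-room n 1 lt) }
    ; f-above = unit-above 1
    ; g-fails = record { vanishes-above = unit-above 0 ; holds-before = λ n () ; fails = trans (xor-identityʳ _) u₀≡1 }
    ; bound   = s≤s (s≤s z≤n)
    }

  start-zero : u 0 ≡ false → State 2
  start-zero u₀≡0 = record
    { d = 1 ; ℓ′ = 0 ; k = 0 ; f = unit 2 ; g = unit 0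
    ; N≡k+1+d = refl
    ; ℓ′≤k    = z≤n
    ; f-ann   = record { leading = refl ; annihilates = λ n lt → ⊥-elim (no-room n 2 lt) }
    ; f-above = unit-above 2
    ; g-fails = record
      { vanishes-above = unit-above 0
      ; holds-before   = λ { zero _ → trans (xor-identityʳ _) u₀≡0 ; (suc n) (s≤s ()) }
      ; fails          = trans (xor-identityʳ _) u₁≡1 }
    ; bound   = s≤s (s≤s (s≤s (s≤s z≤n)))
    }

  run : ∀ j {N} → State N → State (j + N)
  run zero    st = st
  run (suc j) st = step (run j st)

  from-state : ∀ {N} → State N → Σ ℕ λ ℓ → HasRecurrence u N ℓ × (2 * ℓ ≤ N + 4)
  from-state st = suc (State.d st) , annihilator⇒recurrence (State.f-ann st) , State.bound st

  upper-bound : ∀ N → 1 ≤ N → Σ ℕ λ ℓ → HasRecurrence u N ℓ × (2 * ℓ ≤ N + 4)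
  upper-bound (suc j) _ with u 0 in u₀
  ... | true = from-state (subst State (+-comm j 1) (run j (start-one u₀)))
  upper-bound (suc zero)    _ | false = 1 , ((λ _ → false) , λ n lt → ⊥-elim (no-room n 1 lt)) , s≤s (s≤s z≤n)
  upper-bound (suc (suc j)) _ | false = from-state (subst State (+-comm j 2) (run j (start-zero u₀)))

corollary4 : (v : ℕ → Bool) →
    (∀ m k → m % 2 ≡ 1 → v (m * 2 ^ k) ≡ (m % 4 ≡ᵇ 1)) →
    ∀ N L → 1 ≤ N → IsLinearComplexity v N L →
    (N ≤ 2 * L + 3) × (2 * L ≤ N + 4)
corollary4 v H N L 1≤N complexity@(recurrence , _) = lower , upper
  where
  bounded : ∀ N ℓ f → Annihilator v N ℓ f → N ≤ 2 * ℓ + 3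
  bounded N ℓ f = lower-bound v N ℓ f (paperfolding-eq {v} H N)
  lower : N ≤ 2 * L + 3
  lower = bounded N L _ (proj₂ (recurrence⇒annihilator recurrence))
  upper : 2 * L ≤ N + 4
  upper with Construction.upper-bound v (paperfolding-one {v} H) bounded N 1≤N
  ... | ℓ , short , 2ℓ≤N+4 = ≤-trans (*-monoʳ-≤ 2 (complexity≤length complexity short)) 2ℓ≤N+4
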